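{- If $G$ is a connected graph, then $\gamma_{\rm cg}(G) \le \gamma_{\rm tcg}(G) \le \gamma_{\rm cg}(G) + 2$.
   Context: All graphs are finite and simple. For a vertex $v$ of $G$, $N(v)$ is its open neighborhood and $N[v]=N(v)\cup\{v\}$ its closed neighborhood. The connected domination game on a connected graph $G$ is played by two players, Dominator and Staller, who alternately select previously unselected vertices of $G$, Dominator moving first. Each selected vertex must dominate (i.e. have in its closed neighborhood) at least one vertex not dominated by the previously selected vertices, and at every stage the set of selected vertices must induce a connected subgraph of $G$. The game ends when no legal move exists; Dominator aims to minimize and Staller to maximize the number of selected vertices. With both playing optimally, this number is the connected game domination number $\gamma_{\rm cg}(G)$. The total connected domination game is defined identically except that each selected vertex must totally dominate (i.e. have in its open neighborhood) at least one vertex not totally dominated by previously selected vertices (still with the connectivity requirement at every stage and Dominator moving first); the optimal number of selected vertices is $\gamma_{\rm tcg}(G)$. -}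

module Defs where

open import Data.Nat using (ℕ; _≤_)
open import Data.Fin using (Fin)
open import Data.Bool using (Bool; true; false)
open import Data.Unit using (⊤)
open import Data.List using (List; []; _∷_; length)
open import Data.List.Membership.Propositional using (_∈_; _∉_)
open import Data.Product using (Σ; ∃; _×_; _,_)
open import Data.Sum using (_⊎_)
open import Relation.Nullary using (¬_)
open import Relation.Binary.PropositionalEquality using (_≡_)

record Graph : Set where
  field
    n      : ℕ
    adj    : Fin n → Fin n → Bool
    sym    : ∀ u v → adj u v ≡ adj v u
    irrefl : ∀ v → adj v v ≡ false

module _ (G : Graph) where
  open Graph G

  V : Set
  V = Fin n

  Adj : V → V → Set
  Adj u v = adj u v ≡ true

  data WalkIn (P : V → Set) : V → V → Set where
    here : ∀ {u} → P u → WalkIn P u u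
    step : ∀ {u w v} → P u → Adj u w → WalkIn P w v → WalkIn P u v

  Connected : Set
  Connected = ∀ u v → WalkIn (λ _ → ⊤) u v

  InducedConnected : List V → Set
  InducedConnected S = ∀ u v → u ∈ S → v ∈ S → WalkIn (_∈ S) u v

  Dominated : List V → V → Set
  Dominated S w = ∃ λ s → s ∈ S × (s ≡ w ⊎ Adj s w)

  TotDominated : List V → V → Set
  TotDominated S w = ∃ λ s → s ∈ S × Adj s w

  LegalCG : List V → V → Set
  LegalCG S v = v ∉ S × (∃ λ w → (v ≡ w ⊎ Adj v w) × ¬ Dominated S w)
                × InducedConnected (v ∷ S)

  LegalTCG : List V → V → Set
  LegalTCG S v = v ∉ S × (∃ λ w → Adj v w × ¬ TotDominated S w)
                 × InducedConnected (v ∷ S)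

data Player : Set where
  dominator staller : Player

-- DomCanForce Legal k S p : in the position where the vertices S have been
-- selected and player p is to move, Dominator has a strategy guaranteeing that
-- the game ends with at most k selected vertices, whatever Staller does.
data DomCanForce {V : Set} (Legal : List V → V → Set) (k : ℕ)
       : List V → Player → Set where
  over  : ∀ {S p} → (∀ v → ¬ Legal S v) → length S ≤ k → DomCanForce Legal k S p
  dmove : ∀ {S} v → Legal S v → DomCanForce Legal k (v ∷ S) staller
          → DomCanForce Legal k S dominator
  smove : ∀ {S} → (∃ λ v → Legal S v)
          → (∀ v → Legal S v → DomCanForce Legal k (v ∷ S) dominator)
          → DomCanForce Legal k S staller

IsGameValue : {V : Set} → (List V → V → Set) → ℕ → Set
IsGameValue Legal k = DomCanForce Legal k [] dominator
                      × (∀ j → DomCanForce Legal j [] dominator → k ≤ j)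

IsGammaCG : Graph → ℕ → Set
IsGammaCG G = IsGameValue (LegalCG G)

IsGammaTCG : Graph → ℕ → Set
IsGammaTCG G = IsGameValue (LegalTCG G)

-- After the first move of the connected game, a vertex v is playable exactly when it
-- newly dominates a vertex and has a neighbour among the played vertices (LegalCG⁺).
-- After the first two (adjacent) moves of the total game the played set totally
-- dominates itself, so domination and total domination of the other vertices agree
-- and that game continues as the same residual game. Hence Dominator can follow a
-- total-game strategy in the connected game, giving γcg ≤ γtcg. For the other bound,
-- the residual game obeys a continuation principle: letting Dominator move in
-- Staller's place, or adding a vertex adjacent to the played set, costs Dominator at
-- most one move each (he imagines the extra vertex already played; vertices that
-- dominate nothing new can be inserted or deleted freely). In the total game Dominator
-- starts with the first vertex x of an optimal connected-game strategy, Staller must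
-- answer with a neighbour of x, and these two effects cost at most two moves.

module Submission where

open import Defs
open import Data.Nat using (ℕ; zero; suc; _≤_; _+_; s≤s)
open import Data.Nat.Properties
  using (≤-refl; ≤-reflexive; ≤-trans; ≤-total; ≤-antisym; n≤1+n; m≤n+m; +-suc; +-comm; +-identityʳ; +-monoˡ-≤; +-cancelʳ-≤; 1+n≰n)
open import Data.Fin using (Fin; zero; suc; _≟_; fromℕ<)
import Data.Fin.Properties as Fin
open import Data.Bool using (true)
import Data.Bool.Properties as Bool
open import Data.Product using (Σ; ∃; ∃₂; _×_; _,_; proj₁; proj₂)
open import Data.Sum using (_⊎_; inj₁; inj₂)
open import Data.Unit using (⊤; tt)
open import Data.Empty using (⊥; ⊥-elim)
open import Data.List using (List; []; _∷_; length; lookup; allFin)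
open import Data.List.Relation.Unary.Any using (here; there; any?)
open import Data.List.Membership.Propositional using (_∈_; _∉_; find; lose)
open import Data.List.Membership.Propositional.Properties using (∈-allFin; ∈-lookup)
open import Data.List.Relation.Binary.Subset.Propositional using (_⊆_)
open import Data.List.Relation.Binary.Subset.Propositional.Properties using (xs⊆x∷xs; ∷⁺ʳ)
open import Function using (_∘_; flip; case_of_)
open import Function.Definitions using (Injective)
open import Relation.Nullary using (¬_; Dec; yes; no)
open import Relation.Nullary.Decidable using (map′; _×-dec_; _⊎-dec_; ¬?)
open import Relation.Unary using (Decidable)
open import Relation.Binary.PropositionalEquality using (_≡_; _≢_; refl; sym; trans; cong; subst)

Distinct : {A : Set} → List A → Set
Distinct []       = ⊤
Distinct (x ∷ xs) = x ∉ xs × Distinct xs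

lookup-injective : {A : Set} (xs : List A) → Distinct xs → Injective _≡_ _≡_ (lookup xs)
lookup-injective (x ∷ xs) d {zero} {zero} _ = refl
lookup-injective (x ∷ xs) (x∉xs , _) {zero} {suc j} e = ⊥-elim (x∉xs (subst (_∈ xs) (sym e) (∈-lookup j)))
lookup-injective (x ∷ xs) (x∉xs , _) {suc i} {zero} e = ⊥-elim (x∉xs (subst (_∈ xs) e (∈-lookup i)))
lookup-injective (x ∷ xs) (_ , d) {suc i} {suc j} e = cong suc (lookup-injective xs d e)

Distinct⇒length≤ : ∀ {n} (S : List (Fin n)) → Distinct S → length S ≤ n
Distinct⇒length≤ S d = Fin.injective⇒≤ (lookup-injective S d)

anyMember? : {A : Set} {P : A → Set} → Decidable P → ∀ S → Dec (∃ λ s → s ∈ S × P s)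
anyMember? P? S = map′ find (λ (_ , s∈S , ps) → lose s∈S ps) (any? P? S)

∉-∷ : {A : Set} {x y : A} {S : List A} → x ≢ y → x ∉ S → x ∉ y ∷ S
∉-∷ x≢y _   (here x≡y)  = x≢y x≡y
∉-∷ _   x∉S (there x∈S) = x∉S x∈S

∃∈-mono : {A : Set} {P : A → Set} {S T : List A} → S ⊆ T → (∃ λ s → s ∈ S × P s) → ∃ λ s → s ∈ T × P s
∃∈-mono S⊆T (s , s∈S , ps) = s , S⊆T s∈S , ps

Fin-other : ∀ {n} → 2 ≤ n → (v : Fin n) → ∃ λ w → v ≢ w
Fin-other (s≤s (s≤s _)) zero    = suc zero , λ ()
Fin-other (s≤s (s≤s _)) (suc _) = zero , λ ()

module _ {V : Set} {Legal : List V → V → Set} where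

  DomCanForce⇒length≤ : ∀ {k S p} → DomCanForce Legal k S p → length S ≤ k
  DomCanForce⇒length≤ (over _ len)      = len
  DomCanForce⇒length≤ (dmove _ _ T)     = ≤-trans (n≤1+n _) (DomCanForce⇒length≤ T)
  DomCanForce⇒length≤ (smove (v , l) h) = ≤-trans (n≤1+n _) (DomCanForce⇒length≤ (h v l))

  DomCanForce-mono : ∀ {k k′ S p} → k ≤ k′ → DomCanForce Legal k S p → DomCanForce Legal k′ S p
  DomCanForce-mono k≤k′ (over stuck len) = over stuck (≤-trans len k≤k′)
  DomCanForce-mono k≤k′ (dmove v l T)    = dmove v l (DomCanForce-mono k≤k′ T)
  DomCanForce-mono k≤k′ (smove move h)   = smove move (λ v l → DomCanForce-mono k≤k′ (h v l))

record Simulation {V : Set} (Legal : List V → V → Set) (R : List V → List V → Set) : Set where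
  field
    forth  : ∀ {A B v} → R A B → Legal A v → Legal B v
    back   : ∀ {A B v} → R A B → Legal B v → Legal A v
    extend : ∀ {A B} v → R A B → R (v ∷ A) (v ∷ B)

module _ {V : Set} {Legal : List V → V → Set} {R : List V → List V → Set} where

  Simulation-flip : Simulation Legal R → Simulation Legal (flip R)
  Simulation-flip sim = record { forth = back ; back = forth ; extend = extend }
    where open Simulation sim

  simulate : Simulation Legal R → ∀ {k k′ A B p} → R A B → length A + k ≤ length B + k′
           → DomCanForce Legal k B p → DomCanForce Legal k′ A p
  simulate sim {k} {k′} {A} {B} r len (over stuck lenB) =
    over (λ v → stuck v ∘ forth r)
         (+-cancelʳ-≤ k (length A) k′
           (≤-trans len (≤-trans (+-monoˡ-≤ k′ lenB) (≤-reflexive (+-comm k k′)))))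
    where open Simulation sim
  simulate sim r len (dmove v l T) =
    dmove v (back r l) (simulate sim (extend v r) (s≤s len) T)
    where open Simulation sim
  simulate sim r len (smove (v , l) h) =
    smove (v , back r l) (λ w l′ → simulate sim (extend w r) (s≤s len) (h w (forth r l′)))
    where open Simulation sim

record Agreement {V : Set} (Q : List V → Set) (L₁ L₂ : List V → V → Set) : Set where
  field
    to   : ∀ {S v} → Q S → L₁ S v → L₂ S v
    from : ∀ {S v} → Q S → L₂ S v → L₁ S v
    closed : ∀ {S v} → Q S → L₁ S v → Q (v ∷ S)

module _ {V : Set} {Q : List V → Set} {L₁ L₂ : List V → V → Set} where

  Agreement-sym : Agreement Q L₁ L₂ → Agreement Q L₂ L₁
  Agreement-sym agr = record { to = from ; from = to ; closed = λ q → closed q ∘ from q }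
    where open Agreement agr

  transfer : Agreement Q L₁ L₂ → ∀ {k S p} → Q S → DomCanForce L₁ k S p → DomCanForce L₂ k S p
  transfer agr q (over stuck len) = over (λ v → stuck v ∘ from q) len
    where open Agreement agr
  transfer agr q (dmove v l T) = dmove v (to q l) (transfer agr (closed q l) T)
    where open Agreement agr
  transfer agr q (smove (v , l) h) =
    smove (v , to q l) (λ w l₂ → transfer agr (closed q (from q l₂)) (h w (from q l₂)))
    where open Agreement agr

module _ {A : Set} {P : A → Set} (P? : Decidable P)
         {Opt : A → ℕ → Set} (opt : ∀ {x} → P x → ∃ (Opt x))
         (opt-unique : ∀ {x k j} → Opt x k → Opt x j → k ≡ j)
         {_≼_ : ℕ → ℕ → Set} (≼-reflexive : ∀ {k j} → k ≡ j → k ≼ j)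
         (≼-trans : ∀ {i j k} → i ≼ j → j ≼ k → i ≼ k) (≼-total : ∀ k j → k ≼ j ⊎ j ≼ k) where

  Extremum : List A → Set
  Extremum xs = ∃₂ λ x k → P x × Opt x k × (∀ {y j} → y ∈ xs → P y → Opt y j → k ≼ j)

  extremum : ∀ xs → (∀ {y} → y ∈ xs → ¬ P y) ⊎ Extremum xs
  extremum [] = inj₁ λ ()
  extremum (x ∷ xs) with P? x | extremum xs
  ... | no ¬px | inj₁ none = inj₁ λ { (here refl) → ¬px ; (there y∈) → none y∈ }
  ... | no ¬px | inj₂ (z , k , pz , oz , best) =
    inj₂ (z , k , pz , oz , λ { (here refl) py → ⊥-elim (¬px py) ; (there y∈) → best y∈ })
  ... | yes px | r with opt px
  ...   | kx , ox with r
  ...     | inj₁ none =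
    inj₂ (x , kx , px , ox , λ { (here refl) _ oy → ≼-reflexive (opt-unique ox oy)
                               ; (there y∈) py → ⊥-elim (none y∈ py) })
  ...     | inj₂ (z , k , pz , oz , best) with ≼-total kx k
  ...       | inj₁ kx≼k =
    inj₂ (x , kx , px , ox , λ { (here refl) _ oy → ≼-reflexive (opt-unique ox oy)
                               ; (there y∈) py oy → ≼-trans kx≼k (best y∈ py oy) })
  ...       | inj₂ k≼kx =
    inj₂ (z , k , pz , oz , λ { (here refl) _ oy → ≼-trans k≼kx (≼-reflexive (opt-unique ox oy))
                              ; (there y∈) → best y∈ })

module _ {n : ℕ} where

  fuel-exhausted : ∀ {S : List (Fin n)} {v} → Distinct S → v ∉ S → n ≤ length S + 0 → ⊥
  fuel-exhausted {S} d v∉S fuel =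
    1+n≰n (≤-trans (Distinct⇒length≤ (_ ∷ S) (v∉S , d)) (≤-trans fuel (≤-reflexive (+-identityʳ (length S)))))

  fuel-step : ∀ {S : List (Fin n)} {f} v → n ≤ length S + suc f → n ≤ length (v ∷ S) + f
  fuel-step {S} {f} v fuel = ≤-trans fuel (≤-reflexive (+-suc (length S) f))

module _ {V : Set} (Legal : List V → V → Set) where

  Optimal : ℕ → List V → Player → Set
  Optimal k S p = DomCanForce Legal k S p × (∀ j → DomCanForce Legal j S p → k ≤ j)

  Optimal-unique : ∀ {k j S p} → Optimal k S p → Optimal j S p → k ≡ j
  Optimal-unique (Tk , k-least) (Tj , j-least) = ≤-antisym (k-least _ Tj) (j-least _ Tk)

  Optimal-terminal : ∀ {S p} → (∀ v → ¬ Legal S v) → Optimal (length S) S p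
  Optimal-terminal stuck = over stuck ≤-refl , λ _ → DomCanForce⇒length≤

opponent : Player → Player
opponent dominator = staller
opponent staller   = dominator

module GameValue {n : ℕ} (Legal : List (Fin n) → Fin n → Set) (Reachable : List (Fin n) → Set)
                 (reachable-step : ∀ {S v} → Reachable S → Legal S v → Reachable (v ∷ S))
                 (legal-fresh : ∀ {S v} → Legal S v → v ∉ S)
                 (legal? : ∀ {S} → Reachable S → Decidable (Legal S)) where

  Reply : List (Fin n) → Player → Set
  Reply S p = ∀ {y} → Legal S y → ∃ λ k → Optimal Legal k (y ∷ S) (opponent p)

  optimal-step : ∀ p {S} → Reachable S → Reply S p → ∃ λ k → Optimal Legal k S p
  optimal-step dominator {S} r reply
    with extremum (legal? r) reply (Optimal-unique Legal) ≤-reflexive ≤-trans ≤-total (allFin n)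
  ... | inj₁ none = _ , Optimal-terminal Legal (λ v → none (∈-allFin v))
  ... | inj₂ (y , k , l , (T , _) , best) = k , dmove y l T , least
    where
    least : ∀ j → DomCanForce Legal j S dominator → k ≤ j
    least j (over stuck _)  = ⊥-elim (stuck y l)
    least j (dmove v lv Tv) = ≤-trans (best (∈-allFin v) lv optimal-v) (proj₂ optimal-v j Tv)
      where optimal-v = proj₂ (reply lv)
  optimal-step staller {S} r reply
    with extremum (legal? r) reply (Optimal-unique Legal) (≤-reflexive ∘ sym) (flip ≤-trans) (flip ≤-total) (allFin n)
  ... | inj₁ none = _ , Optimal-terminal Legal (λ v → none (∈-allFin v))
  ... | inj₂ (y , k , l , (_ , k-least) , best) = k , smove (y , l) forced , least
    where
    forced : ∀ v → Legal S v → DomCanForce Legal k (v ∷ S) dominator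
    forced v lv = DomCanForce-mono (best (∈-allFin v) lv optimal-v) (proj₁ optimal-v)
      where optimal-v = proj₂ (reply lv)
    least : ∀ j → DomCanForce Legal j S staller → k ≤ j
    least j (over stuck _) = ⊥-elim (stuck y l)
    least j (smove _ h)    = k-least j (h y l)

  optimal : ∀ f p {S} → Distinct S → Reachable S → n ≤ length S + f → ∃ λ k → Optimal Legal k S p
  optimal zero p d r fuel = _ , Optimal-terminal Legal (λ v l → fuel-exhausted d (legal-fresh l) fuel)
  optimal (suc f) p {S} d r fuel =
    optimal-step p r (λ {y} l → optimal f (opponent p) (legal-fresh l , d) (reachable-step r l) (fuel-step {S = S} y fuel))

  gameValue : Reachable [] → ∃ (IsGameValue Legal)
  gameValue r = optimal n dominator {[]} tt r ≤-refl

module _ (G : Graph) where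
  open Graph G using (n; adj; irrefl)
  open import Data.List.Membership.DecPropositional (_≟_ {n}) using (_∈?_)

  Adj-sym : ∀ {u v} → Adj G u v → Adj G v u
  Adj-sym {u} {v} uv = trans (Graph.sym G v u) uv

  Adj-irrefl : ∀ {v} → ¬ Adj G v v
  Adj-irrefl {v} vv with trans (sym vv) (irrefl v)
  ... | ()

  Adj? : ∀ u v → Dec (Adj G u v)
  Adj? u v = adj u v Bool.≟ true

  WalkIn-map : ∀ {P Q : V G → Set} {a b} → (∀ {x} → P x → Q x) → WalkIn G P a b → WalkIn G Q a b
  WalkIn-map f (here pa)      = here (f pa)
  WalkIn-map f (step pa ab w) = step (f pa) ab (WalkIn-map f w)

  WalkIn-++ : ∀ {P : V G → Set} {a b c} → WalkIn G P a b → WalkIn G P b c → WalkIn G P a c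
  WalkIn-++ (here _)       w′ = w′
  WalkIn-++ (step pa ab w) w′ = step pa ab (WalkIn-++ w w′)

  WalkIn-firstStep : ∀ {P : V G → Set} {a b} → WalkIn G P a b → a ≢ b → ∃ λ w → Adj G a w × P w
  WalkIn-firstStep (here _)                   a≢a = ⊥-elim (a≢a refl)
  WalkIn-firstStep (step _ ab (here pw))      _   = _ , ab , pw
  WalkIn-firstStep (step _ ab (step pw _ _))  _   = _ , ab , pw

  InducedConnected-singleton : ∀ x → InducedConnected G (x ∷ [])
  InducedConnected-singleton x _ _ (here refl) (here refl) = here (here refl)

  InducedConnected-extend : ∀ {S v} → InducedConnected G S → TotDominated G S v → InducedConnected G (v ∷ S)
  InducedConnected-extend {S} {v} conn (s , s∈S , sv) = walk
    where
    lift : ∀ {x y} → WalkIn G (_∈ S) x y → WalkIn G (_∈ v ∷ S) x y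
    lift = WalkIn-map there
    walk : InducedConnected G (v ∷ S)
    walk _ _ (here refl) (here refl) = here (here refl)
    walk _ y (here refl) (there y∈S) = step (here refl) (Adj-sym sv) (lift (conn s y s∈S y∈S))
    walk x _ (there x∈S) (here refl) = WalkIn-++ (lift (conn x s x∈S s∈S)) (step (there s∈S) sv (here (here refl)))
    walk x y (there x∈S) (there y∈S) = lift (conn x y x∈S y∈S)

  InducedConnected⇒TotDominated : ∀ {S v s} → s ∈ S → v ∉ S → InducedConnected G (v ∷ S) → TotDominated G S v
  InducedConnected⇒TotDominated s∈S v∉S conn
    with WalkIn-firstStep (conn _ _ (here refl) (there s∈S)) (λ { refl → v∉S s∈S })
  ... | _ , vw , here refl  = ⊥-elim (Adj-irrefl vw)
  ... | w , vw , there w∈S = w , w∈S , Adj-sym vw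

  NewlyDominates : List (V G) → V G → Set
  NewlyDominates S v = ∃ λ w → (v ≡ w ⊎ Adj G v w) × ¬ Dominated G S w

  LegalCG⁺ : List (V G) → V G → Set
  LegalCG⁺ S v = v ∉ S × NewlyDominates S v × TotDominated G S v

  Dominated? : ∀ S → Decidable (Dominated G S)
  Dominated? S w = anyMember? (λ s → (s ≟ w) ⊎-dec Adj? s w) S

  NewlyDominates? : ∀ S → Decidable (NewlyDominates S)
  NewlyDominates? S v = Fin.any? (λ w → ((v ≟ w) ⊎-dec Adj? v w) ×-dec ¬? (Dominated? S w))

  LegalCG⁺? : ∀ S → Decidable (LegalCG⁺ S)
  LegalCG⁺? S v = ¬? (v ∈? S) ×-dec NewlyDominates? S v ×-dec anyMember? (λ s → Adj? s v) S

  Dominated-mono : ∀ {A B w} → A ⊆ B → Dominated G A w → Dominated G B w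
  Dominated-mono = ∃∈-mono

  TotDominated-mono : ∀ {A B w} → A ⊆ B → TotDominated G A w → TotDominated G B w
  TotDominated-mono = ∃∈-mono

  ¬NewlyDominates⇒dominated : ∀ {S u w} → ¬ NewlyDominates S u → u ≡ w ⊎ Adj G u w → Dominated G S w
  ¬NewlyDominates⇒dominated {S} {w = w} old uw with Dominated? S w
  ... | yes dom = dom
  ... | no ¬dom = ⊥-elim (old (w , uw , ¬dom))

  -- A = B ∪ {u} as sets and B dominates N[u]; u ∈ B is allowed, so reorderings of
  -- the played vertices are covered as well.
  record UselessExtension (u : V G) (A B : List (V G)) : Set where
    field
      ⊆-∷ : A ⊆ u ∷ B
      ⊇   : B ⊆ A
      useless : ∀ {w} → u ≡ w ⊎ Adj G u w → Dominated G B w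

  UselessExtension-simulation : ∀ u → Simulation LegalCG⁺ (UselessExtension u)
  UselessExtension-simulation u = record { forth = forth ; back = back ; extend = extend }
    where
    open UselessExtension
    forth : ∀ {A B v} → UselessExtension u A B → LegalCG⁺ A v → LegalCG⁺ B v
    forth ext (v∉A , (w , vw , ¬domA) , (s , s∈A , sv)) =
      v∉A ∘ ⊇ ext , (w , vw , ¬domA ∘ Dominated-mono (⊇ ext)) , neighbour (⊆-∷ ext s∈A)
      where
      neighbour : s ∈ u ∷ _ → TotDominated G _ _
      neighbour (there s∈B) = s , s∈B , sv
      neighbour (here refl) with useless ext (inj₂ sv)
      ... | _ , s′∈B , inj₁ refl = ⊥-elim (v∉A (⊇ ext s′∈B))
      ... | s′ , s′∈B , inj₂ s′v = s′ , s′∈B , s′v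
    back : ∀ {A B v} → UselessExtension u A B → LegalCG⁺ B v → LegalCG⁺ A v
    back ext (v∉B , (w , vw , ¬domB) , nb) =
      v∉A , (w , vw , ¬domA) , TotDominated-mono (⊇ ext) nb
      where
      v∉A : _ ∉ _
      v∉A v∈A with ⊆-∷ ext v∈A
      ... | here refl  = ¬domB (useless ext vw)
      ... | there v∈B = v∉B v∈B
      ¬domA : ¬ Dominated G _ w
      ¬domA (s , s∈A , sw) with ⊆-∷ ext s∈A
      ... | here refl  = ¬domB (useless ext sw)
      ... | there s∈B = ¬domB (s , s∈B , sw)
    extend : ∀ {A B} v → UselessExtension u A B → UselessExtension u (v ∷ A) (v ∷ B)
    extend v ext = record
      { ⊆-∷     = ⊆-∷′
      ; ⊇       = ∷⁺ʳ v (⊇ ext)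
      ; useless = Dominated-mono (xs⊆x∷xs _ v) ∘ useless ext
      }
      where
      ⊆-∷′ : v ∷ _ ⊆ u ∷ v ∷ _
      ⊆-∷′ (here refl) = there (here refl)
      ⊆-∷′ (there x∈A) with ⊆-∷ ext x∈A
      ... | here x≡u  = here x≡u
      ... | there x∈B = there (there x∈B)

  D⁺ : ℕ → List (V G) → Player → Set
  D⁺ = DomCanForce LegalCG⁺

  UselessExtension-∷ : ∀ {S u} → ¬ NewlyDominates S u → UselessExtension u (u ∷ S) S
  UselessExtension-∷ {S} {u} old =
    record { ⊆-∷ = λ x → x ; ⊇ = xs⊆x∷xs S u ; useless = ¬NewlyDominates⇒dominated old }

  addUseless : ∀ {k S u p} → ¬ NewlyDominates S u → D⁺ k S p → D⁺ (suc k) (u ∷ S) p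
  addUseless {k} {S} {u} old =
    simulate (UselessExtension-simulation u) (UselessExtension-∷ old) (≤-reflexive (sym (+-suc (length S) k)))

  removeUseless : ∀ {k S u p} → ¬ NewlyDominates S u → D⁺ (suc k) (u ∷ S) p → D⁺ k S p
  removeUseless {k} {S} {u} old =
    simulate (Simulation-flip (UselessExtension-simulation u)) (UselessExtension-∷ old) (≤-reflexive (+-suc (length S) k))

  swap : ∀ {k a b S p} → D⁺ k (a ∷ b ∷ S) p → D⁺ k (b ∷ a ∷ S) p
  swap {a = a} {b} {S} =
    simulate (UselessExtension-simulation a)
      (record { ⊆-∷ = there ∘ exchange ; ⊇ = exchange ; useless = λ aw → a , here refl , aw })
      ≤-refl
    where
    exchange : ∀ {x y} → x ∷ y ∷ S ⊆ y ∷ x ∷ S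
    exchange (here refl)         = there (here refl)
    exchange (there (here refl)) = here refl
    exchange (there (there z∈S)) = there (there z∈S)

  anyLegalCG⁺? : ∀ S → Dec (∃ (LegalCG⁺ S))
  anyLegalCG⁺? S = Fin.any? (LegalCG⁺? S)

  -- The fuel bounds the number of vertices not yet played.
  private module Fuelled where
    mutual
      addVertex-dominator : ∀ f {k I u} → Distinct I → n ≤ length I + f → u ∉ I → TotDominated G I u
                          → D⁺ k I dominator → D⁺ (suc k) (u ∷ I) dominator
      addVertex-dominator zero d fuel u∉I _ _ = ⊥-elim (fuel-exhausted d u∉I fuel)
      addVertex-dominator (suc f) {I = I} {u} d fuel u∉I uI T with NewlyDominates? I u
      ... | no old  = addUseless old T
      ... | yes new with T
      ...   | over stuck _ = ⊥-elim (stuck u (u∉I , new , uI))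
      ...   | dmove x (x∉I , xnew , xI) T′ with x ≟ u
      ...     | yes refl = seizeTurn f (u∉I , d) (fuel-step {S = I} u fuel) T′
      -- If u has made x useless, Dominator drops x and moves in Staller's place instead.
      ...     | no x≢u = case NewlyDominates? (u ∷ I) x of λ
        { (yes xnew′) → dmove x (∉-∷ x≢u x∉I , xnew′ , TotDominated-mono (xs⊆x∷xs I u) xI) answer
        ; (no xold)   → seizeTurn f (u∉I , d) (fuel-step {S = I} u fuel) (removeUseless xold answer)
        }
        where
        answer : D⁺ (suc _) (x ∷ u ∷ I) staller
        answer = swap (addVertex-staller f (x∉I , d) (fuel-step {S = I} x fuel)
                         (∉-∷ (x≢u ∘ sym) u∉I) (TotDominated-mono (xs⊆x∷xs I x) uI) T′)

      addVertex-staller : ∀ f {k I u} → Distinct I → n ≤ length I + f → u ∉ I → TotDominated G I u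
                        → D⁺ k I staller → D⁺ (suc k) (u ∷ I) staller
      addVertex-staller zero d fuel u∉I _ _ = ⊥-elim (fuel-exhausted d u∉I fuel)
      addVertex-staller (suc f) {I = I} {u} d fuel u∉I uI T with NewlyDominates? I u
      ... | no old  = addUseless old T
      ... | yes new with T | anyLegalCG⁺? (u ∷ I)
      ...   | over stuck _ | _       = ⊥-elim (stuck u (u∉I , new , uI))
      ...   | smove _ _    | no none = over (λ v l → none (v , l)) (s≤s (DomCanForce⇒length≤ T))
      ...   | smove _ h    | yes move =
        smove move λ v (v∉u∷I , _ , vuI) →
          addVertex-dominator f (u∉I , d) (fuel-step {S = I} u fuel) v∉u∷I vuI (h u (u∉I , new , uI))

      seizeTurn : ∀ f {k S} → Distinct S → n ≤ length S + f → D⁺ k S staller → D⁺ (suc k) S dominator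
      seizeTurn f d fuel (over stuck len) = over stuck (≤-trans len (n≤1+n _))
      seizeTurn f d fuel T@(smove (w , lw@(w∉S , _ , wS)) _) = dmove w lw (addVertex-staller f d fuel w∉S wS T)

  addVertex : ∀ {k I u} → Distinct I → u ∉ I → TotDominated G I u → D⁺ k I dominator → D⁺ (suc k) (u ∷ I) dominator
  addVertex {I = I} d = Fuelled.addVertex-dominator n d (m≤n+m n (length I))

  seizeTurn : ∀ {k S} → Distinct S → D⁺ k S staller → D⁺ (suc k) S dominator
  seizeTurn {S = S} d = Fuelled.seizeTurn n d (m≤n+m n (length S))

  NonemptyConnected : List (V G) → Set
  NonemptyConnected S = (∃ λ s → s ∈ S) × InducedConnected G S

  cg-agreement : Agreement NonemptyConnected LegalCG⁺ (LegalCG G)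
  cg-agreement = record
    { to     = λ (_ , conn) (v∉S , new , vS) → v∉S , new , InducedConnected-extend conn vS
    ; from   = λ ((_ , s∈S) , _) (v∉S , new , conn) → v∉S , new , InducedConnected⇒TotDominated s∈S v∉S conn
    ; closed = λ (_ , conn) (_ , _ , vS) → (_ , here refl) , InducedConnected-extend conn vS
    }

  TotallyConnected : List (V G) → Set
  TotallyConnected S = NonemptyConnected S × (∀ {s} → s ∈ S → TotDominated G S s)

  tcg-agreement : Agreement TotallyConnected LegalCG⁺ (LegalTCG G)
  tcg-agreement = record { to = to ; from = from ; closed = closed }
    where
    to : ∀ {S v} → TotallyConnected S → LegalCG⁺ S v → LegalTCG G S v
    to (_ , _)    (_ , (_ , inj₁ refl , ¬dom) , (s , s∈S , sv)) = ⊥-elim (¬dom (s , s∈S , inj₂ sv))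
    to (nc , _)   (v∉S , (w , inj₂ vw , ¬dom) , vS) =
      v∉S , (w , vw , λ (s , s∈S , sw) → ¬dom (s , s∈S , inj₂ sw)) , InducedConnected-extend (proj₂ nc) vS
    from : ∀ {S v} → TotallyConnected S → LegalTCG G S v → LegalCG⁺ S v
    from (((_ , s∈S) , _) , self) (v∉S , (w , vw , ¬tot) , conn) =
      v∉S , (w , inj₂ vw , ¬tot ∘ totally) , InducedConnected⇒TotDominated s∈S v∉S conn
      where
      totally : ∀ {w} → Dominated G _ w → TotDominated G _ w
      totally (s , s∈S , inj₁ refl) = self s∈S
      totally (s , s∈S , inj₂ sw)   = s , s∈S , sw
    closed : ∀ {S v} → TotallyConnected S → LegalCG⁺ S v → TotallyConnected (v ∷ S)
    closed {S} {v} (nc , self) l@(_ , _ , vS) = Agreement.closed cg-agreement nc l , self′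
      where
      self′ : ∀ {s} → s ∈ v ∷ S → TotDominated G (v ∷ S) s
      self′ (here refl) = TotDominated-mono (xs⊆x∷xs S v) vS
      self′ (there s∈S) = TotDominated-mono (xs⊆x∷xs S v) (self s∈S)

  NonemptyConnected-singleton : ∀ x → NonemptyConnected (x ∷ [])
  NonemptyConnected-singleton x = (x , here refl) , InducedConnected-singleton x

  TotallyConnected-pair : ∀ {v x} → Adj G v x → TotallyConnected (v ∷ x ∷ [])
  TotallyConnected-pair {v} {x} vx =
    ((v , here refl) , InducedConnected-extend (InducedConnected-singleton x) (x , here refl , Adj-sym vx)) , self
    where
    self : ∀ {s} → s ∈ v ∷ x ∷ [] → TotDominated G (v ∷ x ∷ []) s
    self (here refl)         = x , there (here refl) , Adj-sym vx
    self (there (here refl)) = v , here refl , vx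

  LegalCG-first : ∀ v → LegalCG G [] v
  LegalCG-first v = (λ ()) , (v , inj₁ refl , λ ()) , InducedConnected-singleton v

  LegalTCG-first : ∀ {v w} → Adj G v w → LegalTCG G [] v
  LegalTCG-first {v} {w} vw = (λ ()) , (w , vw , λ ()) , InducedConnected-singleton v

  LegalTCG-second : ∀ {v x} → Adj G v x → LegalTCG G (x ∷ []) v
  LegalTCG-second {v} {x} vx =
    ∉-∷ (λ { refl → Adj-irrefl vx }) (λ ()) ,
    (x , vx , λ { (_ , here refl , xx) → Adj-irrefl xx }) ,
    InducedConnected-extend (InducedConnected-singleton x) (x , here refl , Adj-sym vx)

  InducedConnected-pair⇒Adj : ∀ {v x} → v ∉ x ∷ [] → InducedConnected G (v ∷ x ∷ []) → Adj G v x
  InducedConnected-pair⇒Adj v∉x conn with InducedConnected⇒TotDominated (here refl) v∉x conn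
  ... | _ , here refl , xv = Adj-sym xv

  LegalTCG-second⁻¹ : ∀ {v x} → LegalTCG G (x ∷ []) v → Adj G v x
  LegalTCG-second⁻¹ (v∉x , _ , conn) = InducedConnected-pair⇒Adj v∉x conn

  data CGReachable : List (V G) → Set where
    start : CGReachable []
    grown : ∀ {S} → NonemptyConnected S → CGReachable S

  CGReachable-step : ∀ {S v} → CGReachable S → LegalCG G S v → CGReachable (v ∷ S)
  CGReachable-step start     _ = grown (NonemptyConnected-singleton _)
  CGReachable-step (grown c) l = grown (Agreement.closed (Agreement-sym cg-agreement) c l)

  LegalCG? : ∀ {S} → CGReachable S → Decidable (LegalCG G S)
  LegalCG? start     v = yes (LegalCG-first v)
  LegalCG? (grown c) v = map′ (Agreement.to cg-agreement c) (Agreement.from cg-agreement c) (LegalCG⁺? _ v)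

  data TCGReachable : List (V G) → Set where
    start  : TCGReachable []
    single : ∀ x → TCGReachable (x ∷ [])
    grown  : ∀ {S} → TotallyConnected S → TCGReachable S

  TCGReachable-step : ∀ {S v} → TCGReachable S → LegalTCG G S v → TCGReachable (v ∷ S)
  TCGReachable-step start      _ = single _
  TCGReachable-step (single x) l = grown (TotallyConnected-pair (LegalTCG-second⁻¹ l))
  TCGReachable-step (grown t)  l = grown (Agreement.closed (Agreement-sym tcg-agreement) t l)

  LegalTCG? : ∀ {S} → TCGReachable S → Decidable (LegalTCG G S)
  LegalTCG? start      v = map′ (LegalTCG-first ∘ proj₂) (λ (_ , (w , vw , _) , _) → w , vw) (Fin.any? (Adj? v))
  LegalTCG? (single x) v = map′ LegalTCG-second LegalTCG-second⁻¹ (Adj? v x)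
  LegalTCG? (grown t)  v = map′ (Agreement.to tcg-agreement t) (Agreement.from tcg-agreement t) (LegalCG⁺? _ v)

  γcg-exists : ∃ (IsGammaCG G)
  γcg-exists = GameValue.gameValue (LegalCG G) CGReachable CGReachable-step proj₁ LegalCG? start

  γtcg-exists : ∃ (IsGammaTCG G)
  γtcg-exists = GameValue.gameValue (LegalTCG G) TCGReachable TCGReachable-step proj₁ LegalTCG? start

  module _ (2≤n : 2 ≤ n) (connected : Connected G) where

    hasNeighbour : ∀ v → ∃ (Adj G v)
    hasNeighbour v with Fin-other 2≤n v
    ... | w , v≢w with WalkIn-firstStep (connected v w) v≢w
    ...   | u , vu , _ = u , vu

    tcgStrategy⇒cgStrategy : ∀ {b} → DomCanForce (LegalTCG G) b [] dominator → DomCanForce (LegalCG G) b [] dominator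
    tcgStrategy⇒cgStrategy (over stuck _) = ⊥-elim (stuck v₀ (LegalTCG-first (proj₂ (hasNeighbour v₀))))
      where v₀ = fromℕ< 2≤n
    tcgStrategy⇒cgStrategy {b} (dmove x _ T) = dmove x (LegalCG-first x) (afterFirst T)
      where
      afterFirst : DomCanForce (LegalTCG G) b (x ∷ []) staller → DomCanForce (LegalCG G) b (x ∷ []) staller
      afterFirst (over stuck _) = ⊥-elim (stuck _ (LegalTCG-second (Adj-sym (proj₂ (hasNeighbour x)))))
      afterFirst T@(smove _ h) with anyLegalCG⁺? (x ∷ [])
      ... | no none = over (λ v l → none (v , Agreement.from cg-agreement (NonemptyConnected-singleton x) l))
                           (DomCanForce⇒length≤ T)
      ... | yes (v₀ , l₀) = smove (v₀ , Agreement.to cg-agreement (NonemptyConnected-singleton x) l₀) reply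
        where
        reply : ∀ v → LegalCG G (x ∷ []) v → DomCanForce (LegalCG G) b (v ∷ x ∷ []) dominator
        reply v (v∉x , _ , conn) =
          transfer cg-agreement (proj₁ (TotallyConnected-pair vx))
            (transfer (Agreement-sym tcg-agreement) (TotallyConnected-pair vx) (h v (LegalTCG-second vx)))
          where vx = InducedConnected-pair⇒Adj v∉x conn

    cgStrategy⇒tcgStrategy : ∀ {a} → DomCanForce (LegalCG G) a [] dominator → DomCanForce (LegalTCG G) (a + 2) [] dominator
    cgStrategy⇒tcgStrategy (over stuck _) = ⊥-elim (stuck v₀ (LegalCG-first v₀))
      where v₀ = fromℕ< 2≤n
    cgStrategy⇒tcgStrategy {a} (dmove x _ T) =
      DomCanForce-mono (≤-reflexive (+-comm 2 a))
        (dmove x (LegalTCG-first (proj₂ (hasNeighbour x)))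
           (smove (_ , LegalTCG-second (Adj-sym (proj₂ (hasNeighbour x)))) reply))
      where
      T⁺ : D⁺ a (x ∷ []) staller
      T⁺ = transfer (Agreement-sym cg-agreement) (NonemptyConnected-singleton x) T
      -- Moving first in the connected game after x, and then absorbing Staller's
      -- neighbour v of x, each cost Dominator at most one extra move.
      reply : ∀ v → LegalTCG G (x ∷ []) v → DomCanForce (LegalTCG G) (2 + a) (v ∷ x ∷ []) dominator
      reply v l = transfer tcg-agreement (TotallyConnected-pair vx)
                    (addVertex ((λ ()) , tt) (proj₁ l) (x , here refl , Adj-sym vx) (seizeTurn ((λ ()) , tt) T⁺))
        where vx = LegalTCG-second⁻¹ l

theorem2p1 : (G : Graph) → 2 ≤ Graph.n G → Connected G →
    Σ ℕ (λ a → Σ ℕ (λ b →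
    IsGammaCG G a × IsGammaTCG G b × a ≤ b × b ≤ a + 2))
theorem2p1 G 2≤n connected with γcg-exists G | γtcg-exists G
... | a , γcg@(cg-strategy , cg-least) | b , γtcg@(tcg-strategy , tcg-least) =
  a , b , γcg , γtcg ,
  cg-least b (tcgStrategy⇒cgStrategy G 2≤n connected tcg-strategy) ,
  tcg-least (a + 2) (cgStrategy⇒tcgStrategy G 2≤n connected cg-strategy)
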